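{- Define instruction sequences $P^1_n$ for $n\in\mathbb{N}$ by $P^1_0 = \,!$ and for $n\ge 1$ $$P^1_n = \mathop{;}_{i=1}^{n}\bigl({+}\mathrm{in}{:}i.\mathrm{get} \,;\, \mathrm{aux}{:}1.\mathrm{com}\bigr) \;;\; {+}\mathrm{aux}{:}1.\mathrm{get} \;;\; \mathrm{out}.\mathrm{set}{:}\mathrm{T} \;;\; !,$$ where $\mathop{;}_{i=1}^{n} Q_i$ denotes the concatenation $Q_1;\dots;Q_n$. Then for each $n\in\mathbb{N}$, $P^1_n$ computes the $n$-ary parity function $\mathrm{PAR}_n$.
   Context: Booleans are $\mathrm{F}$ and $\mathrm{T}$. An instruction sequence is a finite sequence $u_1;u_2;\dots;u_k$ of primitive instructions; its length is $k$. Basic instructions are: $\mathrm{in}{:}i.\mathrm{get}$ ($i\ge1$), $\mathrm{out}.\mathrm{set}{:}b$ ($b\in\{\mathrm{F},\mathrm{T}\}$), $\mathrm{aux}{:}i.\mathrm{get}$, $\mathrm{aux}{:}i.\mathrm{set}{:}b$, $\mathrm{aux}{:}i.\mathrm{com}$ ($i\ge1$). Each names a Boolean register ($\mathrm{in}{:}i$ input, $\mathrm{out}$ output, $\mathrm{aux}{:}i$ auxiliary) and a command: $\mathrm{get}$ leaves the register unchanged and replies its content; $\mathrm{set}{:}b$ sets the content to $b$ and replies $b$; $\mathrm{com}$ complements the content and replies the new content. Primitive instructions: for each basic instruction $a$, plain $a$, positive test ${+}a$, negative test ${ - }a$; forward jumps $\#l$ ($l\in\mathbb{N}$); termination $!$.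 Execution starts at $u_1$. ${+}a$ executes $a$ and proceeds with the next instruction if the reply is $\mathrm{T}$, otherwise skips the next instruction and proceeds with the one after; ${ - }a$ likewise with replies reversed; plain $a$ executes $a$ and proceeds with the next instruction; $\#l$ proceeds with the $l$th next instruction; $!$ terminates. If $l=0$ or there is no instruction to proceed with, inaction occurs (no termination). $X$ computes $f:\{\mathrm{F},\mathrm{T}\}^n\to\{\mathrm{F},\mathrm{T}\}$ if there is $k\in\mathbb{N}$ (at least every auxiliary index used in $X$) such that for all $b_1,\dots,b_n$: starting with $\mathrm{in}{:}i$ containing $b_i$, $\mathrm{out}$ containing $\mathrm{F}$, and $\mathrm{aux}{:}1,\dots,\mathrm{aux}{:}k$ containing $\mathrm{F}$, execution terminates with $\mathrm{out}$ containing $f(b_1,\dots,b_n)$. $\mathrm{PAR}_n(b_1,\dots,b_n)=\mathrm{T}$ iff the number of $\mathrm{T}$'s among $b_1,\dots,b_n$ is odd. -}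

module Defs where

open import Data.Bool using (Bool; true; false; not; if_then_else_)
open import Data.Nat using (ℕ; zero; suc; _+_; _≤_; _<_; _%_; _≡ᵇ_)
open import Data.Fin using (Fin; toℕ) renaming (zero to fzero; suc to fsuc)
open import Data.List using (List; []; _∷_; _++_)
open import Data.List.Relation.Unary.All using (All)
open import Data.Maybe using (Maybe; just; nothing)
open import Data.Product using (_×_; _,_; Σ; ∃; proj₁; proj₂)
open import Relation.Binary.PropositionalEquality using (_≡_)
open import Relation.Nullary using (¬_)

-- Booleans: F = false, T = true.

-- Basic instructions (register index i is meant to be ≥ 1, as in the paper)
data Basic : Set where
  inGet  : ℕ → Basic
  outSet : Bool → Basic
  auxGet : ℕ → Basic
  auxSet : ℕ → Bool → Basic
  auxCom : ℕ → Basic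

data Instr : Set where
  plain : Basic → Instr
  ptest : Basic → Instr
  ntest : Basic → Instr
  jmp   : ℕ → Instr
  halt  : Instr

InstrSeq : Set
InstrSeq = List Instr

record State : Set where
  constructor st
  field
    inp : ℕ → Bool
    out : Bool
    aux : ℕ → Bool
open State public

update : (ℕ → Bool) → ℕ → Bool → (ℕ → Bool)
update f i b j = if i ≡ᵇ j then b else f j

-- Effect of a basic instruction: (reply , new state)
exec : Basic → State → Bool × State
exec (inGet i)    s = inp s i , s
exec (outSet b)   s = b , st (inp s) b (aux s)
exec (auxGet i)   s = aux s i , s
exec (auxSet i b) s = b , st (inp s) (out s) (update (aux s) i b)
exec (auxCom i)   s = not (aux s i) , st (inp s) (out s) (update (aux s) i (not (aux s i)))

-- 0-based lookup of the instruction at a position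
at : InstrSeq → ℕ → Maybe Instr
at []       _       = nothing
at (u ∷ _)  zero    = just u
at (_ ∷ us) (suc p) = at us p

-- Run X p s s' : execution of X started at (0-based) position p in state s
-- terminates (reaches !) in finitely many steps with final state s'.
-- Inaction (no instruction at the current position, or #0) has no derivation.
data Run (X : InstrSeq) : ℕ → State → State → Set where
  r-halt  : ∀ {p s} → at X p ≡ just halt → Run X p s s
  r-plain : ∀ {p s s' a} → at X p ≡ just (plain a) →
            Run X (suc p) (proj₂ (exec a s)) s' → Run X p s s'
  r-posT  : ∀ {p s s' a t} → at X p ≡ just (ptest a) → exec a s ≡ (true , t) →
            Run X (suc p) t s' → Run X p s s'
  r-posF  : ∀ {p s s' a t} → at X p ≡ just (ptest a) → exec a s ≡ (false , t) →
            Run X (suc (suc p)) t s' → Run X p s s'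
  r-negF  : ∀ {p s s' a t} → at X p ≡ just (ntest a) → exec a s ≡ (false , t) →
            Run X (suc p) t s' → Run X p s s'
  r-negT  : ∀ {p s s' a t} → at X p ≡ just (ntest a) → exec a s ≡ (true , t) →
            Run X (suc (suc p)) t s' → Run X p s s'
  r-jmp   : ∀ {p s s' l} → at X p ≡ just (jmp l) → ¬ (l ≡ 0) →
            Run X (p + l) s s' → Run X p s s'

auxB : Basic → List ℕ
auxB (inGet _)    = []
auxB (outSet _)   = []
auxB (auxGet i)   = i ∷ []
auxB (auxSet i _) = i ∷ []
auxB (auxCom i)   = i ∷ []

auxI : Instr → List ℕ
auxI (plain a) = auxB a
auxI (ptest a) = auxB a
auxI (ntest a) = auxB a
auxI (jmp _)   = []
auxI halt      = []

auxUsed : InstrSeq → List ℕ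
auxUsed []       = []
auxUsed (u ∷ us) = auxI u ++ auxUsed us

-- X computes f : {F,T}^n → {F,T}.  Registers not mentioned in the definition
-- (in:i for i > n, aux:j for j > k) may hold arbitrary initial contents.
Computes : (n : ℕ) → InstrSeq → ((Fin n → Bool) → Bool) → Set
Computes n X f =
  Σ ℕ λ k → All (λ j → j ≤ k) (auxUsed X) ×
    ((b : Fin n → Bool) (s : State) →
       (∀ (i : Fin n) → inp s (suc (toℕ i)) ≡ b i) →
       out s ≡ false →
       (∀ j → 1 ≤ j → j ≤ k → aux s j ≡ false) →
       Σ State λ s' → Run X 0 s s' × out s' ≡ f b)

countT : (n : ℕ) → (Fin n → Bool) → ℕ
countT zero    b = 0
countT (suc n) b = (if b fzero then 1 else 0) + countT n (λ i → b (fsuc i))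

PAR : (n : ℕ) → (Fin n → Bool) → Bool
PAR n b = (countT n b % 2) ≡ᵇ 1

parBody : ℕ → InstrSeq
parBody zero    = []
parBody (suc n) = parBody n ++ (ptest (inGet (suc n)) ∷ plain (auxCom 1) ∷ [])

P1 : ℕ → InstrSeq
P1 zero    = halt ∷ []
P1 (suc n) = parBody (suc n) ++ (ptest (auxGet 1) ∷ plain (outSet true) ∷ halt ∷ [])

module Submission where

-- Block i complements aux:1 exactly when in:i
-- holds and leaves in and out alone, so after the body aux:1 holds
-- in:1 xor … xor in:n xor (its initial content).  The tail
-- "+aux:1.get ; out.set:T ; !" copies aux:1 into out (still F) and halts.

open import Defs
open import Data.Bool using (Bool; true; false; not; _xor_; if_then_else_)
open import Data.Bool.Properties using (xor-assoc; xor-comm; xor-identityʳ; not-involutive)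
open import Data.Nat using (ℕ; zero; suc; _+_; _≤_; _%_; _≡ᵇ_)
open import Data.Nat.Properties using (+-suc; +-comm; ≤-refl)
open import Data.Nat.DivMod using ([m+n]%n≡m%n)
open import Data.Fin using (Fin; toℕ) renaming (zero to fzero; suc to fsuc)
open import Data.List using ([]; _∷_; _++_; length)
open import Data.List.Properties using (++-assoc; length-++)
open import Data.List.Relation.Unary.All using (All; []; _∷_)
open import Data.List.Relation.Unary.All.Properties using (++⁺)
open import Data.Maybe using (just)
open import Data.Product using (_×_; _,_; Σ; proj₂)
open import Relation.Binary.PropositionalEquality
  using (_≡_; refl; sym; trans; cong; subst; subst₂; module ≡-Reasoning)

-- Addressing: position p of ys is position p + length xs of xs ++ ys.
-- (Written p + length xs so that small literal p reduce to successors.)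
at-++ : ∀ xs ys p → at (xs ++ ys) (p + length xs) ≡ at ys p
at-++ []       ys p = cong (at ys) (+-comm p 0)
at-++ (x ∷ xs) ys p rewrite +-suc p (length xs) = at-++ xs ys p

comIf : Bool → State → State
comIf true  t = proj₂ (exec (auxCom 1) t)
comIf false t = t

afterBody : ℕ → State → State
afterBody zero    s = s
afterBody (suc m) s = comIf (inp (afterBody m s) (suc m)) (afterBody m s)

block-run : ∀ i X L t s' →
  at X L ≡ just (ptest (inGet i)) → at X (suc L) ≡ just (plain (auxCom 1)) →
  Run X (suc (suc L)) (comIf (inp t i) t) s' → Run X L t s'
block-run i X L t s' atTest atCom r with inp t i in reply
... | true  = r-posT atTest (cong (_, t) reply) (r-plain atCom r)
... | false = r-posF atTest (cong (_, t) reply) r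

length-parBody : ∀ m → length (parBody (suc m)) ≡ suc (suc (length (parBody m)))
length-parBody m = trans (length-++ (parBody m)) (+-comm (length (parBody m)) 2)

-- Whatever follows the body, a run of the body from position 0 reaches the
-- end of the body in state afterBody m s; peel off blocks from the right.
body-run : ∀ m R s s' →
  Run (parBody m ++ R) (length (parBody m)) (afterBody m s) s' →
  Run (parBody m ++ R) 0 s s'
body-run zero    R s s' r = r
body-run (suc m) R s s' r =
  subst (λ X → Run X 0 s s') (sym split) (body-run m R' s s' lastBlock)
  where
  R' = ptest (inGet (suc m)) ∷ plain (auxCom 1) ∷ R
  split : parBody (suc m) ++ R ≡ parBody m ++ R'
  split = ++-assoc (parBody m) _ R
  lastBlock : Run (parBody m ++ R') (length (parBody m)) (afterBody m s) s'
  lastBlock = block-run (suc m) _ _ (afterBody m s) s'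
    (at-++ (parBody m) R' 0) (at-++ (parBody m) R' 1)
    (subst₂ (λ X p → Run X p (afterBody (suc m) s) s') split (length-parBody m) r)

tail-run : ∀ X L t →
  at X L ≡ just (ptest (auxGet 1)) → at X (suc L) ≡ just (plain (outSet true)) →
  at X (suc (suc L)) ≡ just halt → out t ≡ false →
  Σ State λ s' → Run X L t s' × out s' ≡ aux t 1
tail-run X L t atTest atSet atHalt outF with aux t 1 in reply
... | true  = _ , r-posT atTest (cong (_, t) reply) (r-plain atSet (r-halt atHalt)) , refl
... | false = t , r-posF atTest (cong (_, t) reply) (r-halt atHalt) , outF

xorUpTo : ℕ → (ℕ → Bool) → Bool
xorUpTo zero    f = false
xorUpTo (suc m) f = f 1 xor xorUpTo m (λ j → f (suc j))

-- The same xor read from the back; this is the order in which the body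
-- visits the inputs.
xorUpTo-snoc : ∀ m f → xorUpTo (suc m) f ≡ xorUpTo m f xor f (suc m)
xorUpTo-snoc zero    f = xor-identityʳ (f 1)
xorUpTo-snoc (suc m) f =
  trans (cong (f 1 xor_) (xorUpTo-snoc m (λ j → f (suc j))))
        (sym (xor-assoc (f 1) _ _))

inp-afterBody : ∀ m s → inp (afterBody m s) ≡ inp s
inp-afterBody zero    s = refl
inp-afterBody (suc m) s with inp (afterBody m s) (suc m)
... | true  = inp-afterBody m s
... | false = inp-afterBody m s

out-afterBody : ∀ m s → out (afterBody m s) ≡ out s
out-afterBody zero    s = refl
out-afterBody (suc m) s with inp (afterBody m s) (suc m)
... | true  = out-afterBody m s
... | false = out-afterBody m s

aux-comIf : ∀ b t → aux (comIf b t) 1 ≡ b xor aux t 1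
aux-comIf true  t = refl
aux-comIf false t = refl

aux-afterBody : ∀ m s → aux (afterBody m s) 1 ≡ xorUpTo m (inp s) xor aux s 1
aux-afterBody zero    s = refl
aux-afterBody (suc m) s = begin
  aux (afterBody (suc m) s) 1                       ≡⟨ aux-comIf (inp (afterBody m s) (suc m)) _ ⟩
  inp (afterBody m s) (suc m) xor aux (afterBody m s) 1
    ≡⟨ cong (λ f → f (suc m) xor aux (afterBody m s) 1) (inp-afterBody m s) ⟩
  inp s (suc m) xor aux (afterBody m s) 1           ≡⟨ cong (inp s (suc m) xor_) (aux-afterBody m s) ⟩
  inp s (suc m) xor (xorUpTo m (inp s) xor aux s 1) ≡⟨ sym (xor-assoc (inp s (suc m)) _ _) ⟩
  (inp s (suc m) xor xorUpTo m (inp s)) xor aux s 1 ≡⟨ cong (_xor aux s 1) (xor-comm (inp s (suc m)) _) ⟩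
  (xorUpTo m (inp s) xor inp s (suc m)) xor aux s 1 ≡⟨ cong (_xor aux s 1) (sym (xorUpTo-snoc m (inp s))) ⟩
  xorUpTo (suc m) (inp s) xor aux s 1               ∎
  where open ≡-Reasoning

odd : ℕ → Bool
odd zero    = false
odd (suc c) = not (odd c)

odd-%2 : ∀ c → (c % 2 ≡ᵇ 1) ≡ odd c
odd-%2 zero          = refl
odd-%2 (suc zero)    = refl
odd-%2 (suc (suc c)) = begin
  (2 + c) % 2 ≡ᵇ 1   ≡⟨ cong (λ x → x % 2 ≡ᵇ 1) (+-comm 2 c) ⟩
  (c + 2) % 2 ≡ᵇ 1   ≡⟨ cong (_≡ᵇ 1) ([m+n]%n≡m%n c 2) ⟩
  c % 2 ≡ᵇ 1         ≡⟨ odd-%2 c ⟩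
  odd c              ≡⟨ sym (not-involutive (odd c)) ⟩
  not (not (odd c))  ∎
  where open ≡-Reasoning

odd-count-step : ∀ x c → odd ((if x then 1 else 0) + c) ≡ x xor odd c
odd-count-step true  c = refl
odd-count-step false c = refl

odd-countT : ∀ n (f : ℕ → Bool) (b : Fin n → Bool) →
  (∀ i → f (suc (toℕ i)) ≡ b i) → odd (countT n b) ≡ xorUpTo n f
odd-countT zero    f b enum = refl
odd-countT (suc n) f b enum = begin
  odd (countT (suc n) b)                      ≡⟨ odd-count-step (b fzero) _ ⟩
  b fzero xor odd (countT n (λ i → b (fsuc i)))
    ≡⟨ cong (_xor _) (sym (enum fzero)) ⟩
  f 1 xor odd (countT n (λ i → b (fsuc i)))
    ≡⟨ cong (f 1 xor_) (odd-countT n (λ j → f (suc j)) (λ i → b (fsuc i)) (λ i → enum (fsuc i))) ⟩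
  xorUpTo (suc n) f                           ∎
  where open ≡-Reasoning

PAR-xor : ∀ n (f : ℕ → Bool) (b : Fin n → Bool) →
  (∀ i → f (suc (toℕ i)) ≡ b i) → PAR n b ≡ xorUpTo n f
PAR-xor n f b enum = trans (odd-%2 (countT n b)) (odd-countT n f b enum)

auxUsed-++ : ∀ xs ys → auxUsed (xs ++ ys) ≡ auxUsed xs ++ auxUsed ys
auxUsed-++ []       ys = refl
auxUsed-++ (x ∷ xs) ys = trans (cong (auxI x ++_) (auxUsed-++ xs ys)) (sym (++-assoc (auxI x) _ _))

auxBound-++ : ∀ k xs ys → All (_≤ k) (auxUsed xs) → All (_≤ k) (auxUsed ys) →
  All (_≤ k) (auxUsed (xs ++ ys))
auxBound-++ k xs ys bxs bys = subst (All (_≤ k)) (sym (auxUsed-++ xs ys)) (++⁺ bxs bys)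

auxUsed-parBody : ∀ m → All (_≤ 1) (auxUsed (parBody m))
auxUsed-parBody zero    = []
auxUsed-parBody (suc m) = auxBound-++ 1 (parBody m) _ (auxUsed-parBody m) (≤-refl ∷ [])

auxUsed-P1 : ∀ n → All (_≤ 1) (auxUsed (P1 n))
auxUsed-P1 zero    = []
auxUsed-P1 (suc n) = auxBound-++ 1 (parBody (suc n)) _ (auxUsed-parBody (suc n)) (≤-refl ∷ [])

P1-run : ∀ n (b : Fin n → Bool) (s : State) →
  (∀ i → inp s (suc (toℕ i)) ≡ b i) → out s ≡ false → aux s 1 ≡ false →
  Σ State λ s' → Run (P1 n) 0 s s' × out s' ≡ PAR n b
P1-run zero    b s enum outF auxF = s , r-halt refl , outF
P1-run (suc n) b s enum outF auxF
  with tail-run (P1 (suc n)) (length (parBody (suc n))) (afterBody (suc n) s)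
         (at-++ (parBody (suc n)) _ 0) (at-++ (parBody (suc n)) _ 1) (at-++ (parBody (suc n)) _ 2)
         (trans (out-afterBody (suc n) s) outF)
... | s' , run , outAux = s' , body-run (suc n) _ s s' run , (begin
  out s'                                                  ≡⟨ outAux ⟩
  aux (afterBody (suc n) s) 1                             ≡⟨ aux-afterBody (suc n) s ⟩
  xorUpTo (suc n) (inp s) xor aux s 1                     ≡⟨ cong (xorUpTo (suc n) (inp s) xor_) auxF ⟩
  xorUpTo (suc n) (inp s) xor false                       ≡⟨ xor-identityʳ _ ⟩
  xorUpTo (suc n) (inp s)                                 ≡⟨ sym (PAR-xor (suc n) (inp s) b enum) ⟩
  PAR (suc n) b                                           ∎)
  where open ≡-Reasoning

proposition2 : (n : ℕ) → Computes n (P1 n) (PAR n)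
proposition2 n = 1 , auxUsed-P1 n , λ b s enum outF auxF →
  P1-run n b s enum outF (auxF 1 ≤-refl ≤-refl)
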